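{- Let $1\leq m\leq n$ and let $P_m\Box P_n$ be the $m$-by-$n$ grid graph (Cartesian product of the paths on $m$ and $n$ vertices). Then: (1) if $m=1$, $\gamma_{1/2}(P_n)=\lceil n/6\rceil$; (2) if $m=2$, $\gamma_{1/2}(P_2\Box P_n)=\lceil n/4\rceil$; (3) if $m\geq 3$, $\gamma_{1/2}(P_m\Box P_n)=\lceil mn/10\rceil$.
   Context: All graphs are finite and simple; $P_k$ denotes the path on $k$ vertices and $\Box$ the Cartesian product. For a graph $G=(V,E)$ and $v\in V$, $N[v]=\{v\}\cup\{u : uv\in E\}$, and for $S\subseteq V$, $N[S]=\bigcup_{u\in S}N[u]$. For $p\in[0,1]$, a set $S\subseteq V$ is a $p$-dominating set if $|N[S]|/|V|\geq p$; the $p$-domination number $\gamma_p(G)$ is the minimum cardinality of a $p$-dominating set of $G$. -}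

module Defs where

open import Data.Bool using (Bool; true; false; _∨_; _∧_)
open import Data.Nat using (ℕ; suc; _+_; _*_; _∸_; _≤_; _≡ᵇ_)
open import Data.Nat.DivMod using (_/_)
open import Data.Fin using (Fin; toℕ)
open import Data.Fin.Properties using () renaming (_≟_ to _≟ᶠ_)
open import Data.Product using (_×_; _,_; ∃; Σ)
open import Data.List using (List; length; filter; allFin; cartesianProduct)
open import Data.Bool.ListAction using (any)
open import Data.List.Relation.Unary.Unique.Propositional using (Unique)
open import Relation.Nullary.Decidable using (⌊_⌋)
open import Relation.Binary.PropositionalEquality using (_≡_)
open import Data.Bool using (T)
open import Relation.Unary using (Decidable)
open import Data.Bool.Properties using (T?)

pathAdj : ∀ {k} → Fin k → Fin k → Bool
pathAdj i j = (suc (toℕ i) ≡ᵇ toℕ j) ∨ (suc (toℕ j) ≡ᵇ toℕ i)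

Vertex : ℕ → ℕ → Set
Vertex m n = Fin m × Fin n

gridAdj : ∀ {m n} → Vertex m n → Vertex m n → Bool
gridAdj (a , b) (c , d) =
  (⌊ a ≟ᶠ c ⌋ ∧ pathAdj b d) ∨ (⌊ b ≟ᶠ d ⌋ ∧ pathAdj a c)

inClosedNbhd : ∀ {m n} → Vertex m n → Vertex m n → Bool
inClosedNbhd (a , b) (c , d) = (⌊ a ≟ᶠ c ⌋ ∧ ⌊ b ≟ᶠ d ⌋) ∨ gridAdj (a , b) (c , d)

vertices : (m n : ℕ) → List (Vertex m n)
vertices m n = cartesianProduct (allFin m) (allFin n)

closedNbhdSize : ∀ {m n} → List (Vertex m n) → ℕ
closedNbhdSize {m} {n} S =
  length (filter (λ u → T? (any (inClosedNbhd u) S)) (vertices m n))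

-- S is a p-dominating set for p = a / b (b > 0):  |N[S]| / |V| ≥ a / b,
-- i.e. b * |N[S]| ≥ a * |V|, where |V| = m * n.
IsPDominating : ∀ {m n} → (a b : ℕ) → List (Vertex m n) → Set
IsPDominating {m} {n} a b S = a * (m * n) ≤ b * closedNbhdSize S

IsPDominationNumber : (m n a b k : ℕ) → Set
IsPDominationNumber m n a b k =
  (Σ (List (Vertex m n)) λ S → Unique S × length S ≡ k × IsPDominating a b S)
  × (∀ (S : List (Vertex m n)) → Unique S → IsPDominating a b S → k ≤ length S)

-- Ceiling division ⌈x / (suc d)⌉.
ceilDiv : ℕ → (d : ℕ) → ℕ
ceilDiv x d = (x + d) / suc d

-- In P_m □ P_n a closed neighbourhood has at most 3 + Δ vertices, where Δ = 0, 1, 2 is the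
-- maximum degree of P_m for m = 1, 2, ≥ 3; hence a ½-dominating set S has mn ≤ 2 (3 + Δ) |S|,
-- which is the lower bound. For the upper bound, ½-dominating sets of small grids are glued
-- side by side (and, for m ≥ 3, on top of each other): a block of width 6, 4 or 10 costs exactly
-- as many vertices as the ceiling grows by, so finitely many small grids, checked by
-- evaluation, cover all sizes.
module Submission where

open import Defs
open import Data.Bool using (Bool; true; false; _∨_; _∧_; T)
open import Data.Bool.ListAction using (any; or)
open import Data.Bool.Properties using (T?; ∨-assoc)
open import Data.Empty using (⊥-elim)
open import Data.Fin using (Fin; toℕ; fromℕ<)
open import Data.Fin.Properties using (toℕ<n; toℕ-fromℕ<) renaming (_≟_ to _≟ᶠ_)
open import Data.List
  using (List; []; _∷_; _++_; map; length; filter; allFin; tabulate; cartesianProduct; upTo; deduplicate)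
open import Data.List.Membership.Propositional.Properties using (∈-upTo⁺)
open import Data.List.Properties
  using (map-++; map-∘; map-cong; map-tabulate; length-++; length-map; length-deduplicate)
open import Data.List.Relation.Unary.All using (All; []; _∷_)
import Data.List.Relation.Unary.All as All
import Data.List.Relation.Unary.All.Properties as AllP
open import Data.List.Relation.Unary.Any.Properties using (any⁺; any⁻; deduplicate⁺; deduplicate⁻)
open import Data.List.Relation.Unary.Unique.DecPropositional.Properties using (deduplicate-!)
open import Data.Nat using (ℕ; zero; suc; _+_; _*_; _∸_; _≤_; _<_; _≡ᵇ_; z≤n; s≤s; z<s; _≤?_; _<?_)
open import Data.Nat.DivMod using (_/_; m*n/n≡m; m<n⇒m/n≡0; /-monoˡ-≤; +-distrib-/-∣ˡ)
open import Data.Nat.Divisibility using (divides-refl)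
open import Data.Nat.Induction using (<-rec)
open import Data.Nat.ListAction using (sum)
open import Data.Nat.ListAction.Properties using (sum-++)
open import Data.Nat.Properties
open import Algebra.Properties.CommutativeSemigroup +-commutativeSemigroup using (interchange)
open import Data.Product using (Σ; _×_; _,_; proj₁; proj₂)
open import Data.Product.Properties using (≡-dec)
open import Data.Unit using (tt)
open import Function using (_∘_)
open import Relation.Binary.Definitions using (DecidableEquality)
open import Relation.Binary.PropositionalEquality
open import Relation.Nullary.Decidable
  using (Dec; yes; no; True; ⌊_⌋; ⌊⌋-map′; toWitness; _×-dec_)

𝟙 : Bool → ℕ
𝟙 true  = 1
𝟙 false = 0

𝟙≤1 : ∀ x → 𝟙 x ≤ 1
𝟙≤1 true  = ≤-refl
𝟙≤1 false = z≤n

𝟙-∨ : ∀ x y → 𝟙 (x ∨ y) ≤ 𝟙 x + 𝟙 y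
𝟙-∨ true  y = s≤s z≤n
𝟙-∨ false y = ≤-refl

𝟙-∨ˡ : ∀ x y → 𝟙 x ≤ 𝟙 (x ∨ y)
𝟙-∨ˡ true  y = ≤-refl
𝟙-∨ˡ false y = z≤n

𝟙-∨ʳ : ∀ x y → 𝟙 y ≤ 𝟙 (x ∨ y)
𝟙-∨ʳ true  y = 𝟙≤1 y
𝟙-∨ʳ false y = ≤-refl

∑ : ℕ → (ℕ → ℕ) → ℕ
∑ zero    f = 0
∑ (suc n) f = f 0 + ∑ n (f ∘ suc)

∑-cong : ∀ n {f g : ℕ → ℕ} → (∀ x → f x ≡ g x) → ∑ n f ≡ ∑ n g
∑-cong zero    f≗g = refl
∑-cong (suc n) f≗g = cong₂ _+_ (f≗g 0) (∑-cong n (f≗g ∘ suc))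

∑-mono-≤ : ∀ n {f g : ℕ → ℕ} → (∀ x → f x ≤ g x) → ∑ n f ≤ ∑ n g
∑-mono-≤ zero    f≤g = z≤n
∑-mono-≤ (suc n) f≤g = +-mono-≤ (f≤g 0) (∑-mono-≤ n (f≤g ∘ suc))

∑-zero : ∀ n → ∑ n (λ _ → 0) ≡ 0
∑-zero zero    = refl
∑-zero (suc n) = ∑-zero n

∑-distrib-+ : ∀ n (f g : ℕ → ℕ) → ∑ n (λ x → f x + g x) ≡ ∑ n f + ∑ n g
∑-distrib-+ zero    f g = refl
∑-distrib-+ (suc n) f g = begin
  (f 0 + g 0) + ∑ n (λ x → f (suc x) + g (suc x))
    ≡⟨ cong (f 0 + g 0 +_) (∑-distrib-+ n (f ∘ suc) (g ∘ suc)) ⟩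
  (f 0 + g 0) + (∑ n (f ∘ suc) + ∑ n (g ∘ suc))
    ≡⟨ interchange (f 0) (g 0) _ _ ⟩
  (f 0 + ∑ n (f ∘ suc)) + (g 0 + ∑ n (g ∘ suc)) ∎
  where open ≡-Reasoning

∑-*ˡ : ∀ n k (f : ℕ → ℕ) → ∑ n (λ x → k * f x) ≡ k * ∑ n f
∑-*ˡ zero    k f = sym (*-zeroʳ k)
∑-*ˡ (suc n) k f = trans (cong (k * f 0 +_) (∑-*ˡ n k (f ∘ suc))) (sym (*-distribˡ-+ k (f 0) _))

∑-*ʳ : ∀ n k (f : ℕ → ℕ) → ∑ n (λ x → f x * k) ≡ ∑ n f * k
∑-*ʳ n k f = trans (∑-cong n (λ x → *-comm (f x) k)) (trans (∑-*ˡ n k f) (*-comm k (∑ n f)))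

∑-+ : ∀ m n (f : ℕ → ℕ) → ∑ (m + n) f ≡ ∑ m f + ∑ n (λ x → f (m + x))
∑-+ zero    n f = refl
∑-+ (suc m) n f = trans (cong (f 0 +_) (∑-+ m n (f ∘ suc))) (sym (+-assoc (f 0) _ _))

any-map : ∀ {A B : Set} (p : B → Bool) (f : A → B) xs → any p (map f xs) ≡ any (p ∘ f) xs
any-map p f xs = cong or (sym (map-∘ xs))

any-++ : ∀ {A : Set} (p : A → Bool) xs ys → any p (xs ++ ys) ≡ any p xs ∨ any p ys
any-++ p []       ys = refl
any-++ p (x ∷ xs) ys = trans (cong (p x ∨_) (any-++ p xs ys)) (sym (∨-assoc (p x) _ _))

Cell : Set
Cell = ℕ × ℕ

_⊕_ : Cell → Cell → Cell
(r , c) ⊕ (a , b) = r + a , c + b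

adjacentᵇ : ℕ → ℕ → Bool
adjacentᵇ i j = (suc i ≡ᵇ j) ∨ (suc j ≡ᵇ i)

closeᵇ : Cell → Cell → Bool
closeᵇ (a , b) (c , d) =
  ((a ≡ᵇ c) ∧ (b ≡ᵇ d)) ∨ (((a ≡ᵇ c) ∧ adjacentᵇ b d) ∨ ((b ≡ᵇ d) ∧ adjacentᵇ a c))

dominatedᵇ : List Cell → Cell → Bool
dominatedᵇ S u = any (closeᵇ u) S

-- Domination is taken in the infinite grid ℕ × ℕ, counting only the cells of the h × w
-- rectangle with corner o. For the vertex set of P_h □ P_w this is |N[S]|
-- (closedNbhdSize≡coverage), and it is invariant under translation, which lets covers be glued.
coverage : List Cell → Cell → ℕ → ℕ → ℕ
coverage S o h w = ∑ h λ a → ∑ w λ b → 𝟙 (dominatedᵇ S (o ⊕ (a , b)))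

translate : Cell → List Cell → List Cell
translate o = map (o ⊕_)

≡ᵇ-+ : ∀ r a x → (r + a ≡ᵇ r + x) ≡ (a ≡ᵇ x)
≡ᵇ-+ zero    a x = refl
≡ᵇ-+ (suc r) a x = ≡ᵇ-+ r a x

adjacentᵇ-+ : ∀ r a x → adjacentᵇ (r + a) (r + x) ≡ adjacentᵇ a x
adjacentᵇ-+ zero    a x = refl
adjacentᵇ-+ (suc r) a x = adjacentᵇ-+ r a x

closeᵇ-⊕ : ∀ o u v → closeᵇ (o ⊕ u) (o ⊕ v) ≡ closeᵇ u v
closeᵇ-⊕ (r , c) (a , b) (x , y)
  rewrite ≡ᵇ-+ r a x | ≡ᵇ-+ c b y | adjacentᵇ-+ r a x | adjacentᵇ-+ c b y = refl

coverage-translate : ∀ o S h w → coverage (translate o S) o h w ≡ coverage S (0 , 0) h w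
coverage-translate o S h w =
  ∑-cong h (λ a → ∑-cong w (λ b → cong 𝟙 (dominatedᵇ-translate (a , b))))
  where
  dominatedᵇ-translate : ∀ u → dominatedᵇ (translate o S) (o ⊕ u) ≡ dominatedᵇ S u
  dominatedᵇ-translate u =
    trans (any-map (closeᵇ (o ⊕ u)) (o ⊕_) S) (cong or (map-cong (closeᵇ-⊕ o u) S))

coverage-++ˡ : ∀ S S′ o h w → coverage S o h w ≤ coverage (S ++ S′) o h w
coverage-++ˡ S S′ o h w = ∑-mono-≤ h (λ a → ∑-mono-≤ w (λ b → let u = o ⊕ (a , b) in
  subst (λ x → 𝟙 (dominatedᵇ S u) ≤ 𝟙 x) (sym (any-++ (closeᵇ u) S S′)) (𝟙-∨ˡ _ _)))

coverage-++ʳ : ∀ S S′ o h w → coverage S′ o h w ≤ coverage (S ++ S′) o h w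
coverage-++ʳ S S′ o h w = ∑-mono-≤ h (λ a → ∑-mono-≤ w (λ b → let u = o ⊕ (a , b) in
  subst (λ x → 𝟙 (dominatedᵇ S′ u) ≤ 𝟙 x) (sym (any-++ (closeᵇ u) S S′)) (𝟙-∨ʳ _ _)))

toCell : ∀ {m n} → Vertex m n → Cell
toCell (a , b) = toℕ a , toℕ b

≟ᶠ-≡ᵇ : ∀ {k} (i j : Fin k) → ⌊ i ≟ᶠ j ⌋ ≡ (toℕ i ≡ᵇ toℕ j)
≟ᶠ-≡ᵇ Fin.zero    Fin.zero    = refl
≟ᶠ-≡ᵇ Fin.zero    (Fin.suc j) = refl
≟ᶠ-≡ᵇ (Fin.suc i) Fin.zero    = refl
≟ᶠ-≡ᵇ (Fin.suc i) (Fin.suc j) = trans (⌊⌋-map′ _ _ (i ≟ᶠ j)) (≟ᶠ-≡ᵇ i j)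

inClosedNbhd-toCell : ∀ {m n} (u v : Vertex m n) →
  inClosedNbhd u v ≡ closeᵇ (toCell u) (toCell v)
inClosedNbhd-toCell (a , b) (c , d) rewrite ≟ᶠ-≡ᵇ a c | ≟ᶠ-≡ᵇ b d = refl

length-filter-T? : ∀ {A : Set} (p : A → Bool) xs →
  length (filter (T? ∘ p) xs) ≡ sum (map (𝟙 ∘ p) xs)
length-filter-T? p []       = refl
length-filter-T? p (x ∷ xs) with p x
... | true  = cong suc (length-filter-T? p xs)
... | false = length-filter-T? p xs

sum-map-cartesianProduct : ∀ {A B : Set} (f : A × B → ℕ) xs ys →
  sum (map f (cartesianProduct xs ys)) ≡ sum (map (λ x → sum (map (λ y → f (x , y)) ys)) xs)
sum-map-cartesianProduct f []       ys = refl
sum-map-cartesianProduct f (x ∷ xs) ys = begin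
  sum (map f (map (x ,_) ys ++ cartesianProduct xs ys))
    ≡⟨ cong sum (map-++ f (map (x ,_) ys) _) ⟩
  sum (map f (map (x ,_) ys) ++ map f (cartesianProduct xs ys))
    ≡⟨ sum-++ (map f (map (x ,_) ys)) _ ⟩
  sum (map f (map (x ,_) ys)) + sum (map f (cartesianProduct xs ys))
    ≡⟨ cong₂ _+_ (cong sum (sym (map-∘ ys))) (sum-map-cartesianProduct f xs ys) ⟩
  sum (map (λ y → f (x , y)) ys) + sum (map (λ x → sum (map (λ y → f (x , y)) ys)) xs) ∎
  where open ≡-Reasoning

sum-tabulate : ∀ n {f : Fin n → ℕ} {g : ℕ → ℕ} → (∀ i → f i ≡ g (toℕ i)) →
  sum (tabulate f) ≡ ∑ n g
sum-tabulate zero    f≗g = refl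
sum-tabulate (suc n) f≗g = cong₂ _+_ (f≗g Fin.zero) (sum-tabulate n (f≗g ∘ Fin.suc))

sum-map-allFin : ∀ n {f : Fin n → ℕ} {g : ℕ → ℕ} → (∀ i → f i ≡ g (toℕ i)) →
  sum (map f (allFin n)) ≡ ∑ n g
sum-map-allFin n {f} f≗g = trans (cong sum (map-tabulate (λ i → i) f)) (sum-tabulate n f≗g)

any-inClosedNbhd : ∀ {m n} (S : List (Vertex m n)) u →
  any (inClosedNbhd u) S ≡ dominatedᵇ (map toCell S) (toCell u)
any-inClosedNbhd S u =
  trans (cong or (map-cong (inClosedNbhd-toCell u) S)) (sym (any-map (closeᵇ (toCell u)) toCell S))

closedNbhdSize≡coverage : ∀ {m n} (S : List (Vertex m n)) →
  closedNbhdSize S ≡ coverage (map toCell S) (0 , 0) m n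
closedNbhdSize≡coverage {m} {n} S = begin
  closedNbhdSize S
    ≡⟨ length-filter-T? dominated (vertices m n) ⟩
  sum (map (𝟙 ∘ dominated) (cartesianProduct (allFin m) (allFin n)))
    ≡⟨ sum-map-cartesianProduct (𝟙 ∘ dominated) (allFin m) (allFin n) ⟩
  sum (map (λ a → sum (map (λ b → 𝟙 (dominated (a , b))) (allFin n))) (allFin m))
    ≡⟨ sum-map-allFin m (λ a → sum-map-allFin n (λ b → cong 𝟙 (any-inClosedNbhd S (a , b)))) ⟩
  coverage (map toCell S) (0 , 0) m n ∎
  where
  open ≡-Reasoning
  dominated : Vertex m n → Bool
  dominated u = any (inClosedNbhd u) S

T-ext : ∀ {x y} → (T x → T y) → (T y → T x) → x ≡ y
T-ext {true}  {true}  _ _ = refl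
T-ext {true}  {false} f _ = ⊥-elim (f tt)
T-ext {false} {true}  _ g = ⊥-elim (g tt)
T-ext {false} {false} _ _ = refl

any-deduplicate : ∀ {A : Set} (_≟_ : DecidableEquality A) (p : A → Bool) xs →
  any p (deduplicate _≟_ xs) ≡ any p xs
any-deduplicate _≟_ p xs = T-ext
  (any⁺ p ∘ deduplicate⁻ _≟_ ∘ any⁻ p (deduplicate _≟_ xs))
  (any⁺ p ∘ deduplicate⁺ _≟_ (λ { refl px → px }) ∘ any⁻ p xs)

_≟ᵛ_ : ∀ {m n} → DecidableEquality (Vertex m n)
_≟ᵛ_ = ≡-dec _≟ᶠ_ _≟ᶠ_

closedNbhdSize-deduplicate : ∀ {m n} (S : List (Vertex m n)) →
  closedNbhdSize (deduplicate _≟ᵛ_ S) ≡ closedNbhdSize S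
closedNbhdSize-deduplicate {m} {n} S = begin
  closedNbhdSize (deduplicate _≟ᵛ_ S)
    ≡⟨ length-filter-T? (λ u → any (inClosedNbhd u) (deduplicate _≟ᵛ_ S)) (vertices m n) ⟩
  sum (map (λ u → 𝟙 (any (inClosedNbhd u) (deduplicate _≟ᵛ_ S))) (vertices m n))
    ≡⟨ cong sum (map-cong (λ u → cong 𝟙 (any-deduplicate _≟ᵛ_ (inClosedNbhd u) S))
                          (vertices m n)) ⟩
  sum (map (λ u → 𝟙 (any (inClosedNbhd u) S)) (vertices m n))
    ≡⟨ length-filter-T? (λ u → any (inClosedNbhd u) S) (vertices m n) ⟨
  closedNbhdSize S ∎
  where open ≡-Reasoning

≡ᵇ-sym : ∀ m n → (m ≡ᵇ n) ≡ (n ≡ᵇ m)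
≡ᵇ-sym zero    zero    = refl
≡ᵇ-sym zero    (suc n) = refl
≡ᵇ-sym (suc m) zero    = refl
≡ᵇ-sym (suc m) (suc n) = ≡ᵇ-sym m n

∑-𝟙-≡ᵇ≤1 : ∀ n t → ∑ n (λ x → 𝟙 (x ≡ᵇ t)) ≤ 1
∑-𝟙-≡ᵇ≤1 zero    t       = z≤n
∑-𝟙-≡ᵇ≤1 (suc n) zero    = ≤-reflexive (cong suc (∑-zero n))
∑-𝟙-≡ᵇ≤1 (suc n) (suc t) = ∑-𝟙-≡ᵇ≤1 n t

pathDegree : ℕ → ℕ → ℕ
pathDegree n c = ∑ n (λ x → 𝟙 (adjacentᵇ x c))

pathDegree≤2 : ∀ n c → pathDegree n c ≤ 2
pathDegree≤2 n c = begin
  ∑ n (λ x → 𝟙 (adjacentᵇ x c))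
    ≤⟨ ∑-mono-≤ n (λ x → 𝟙-∨ (suc x ≡ᵇ c) (suc c ≡ᵇ x)) ⟩
  ∑ n (λ x → 𝟙 (suc x ≡ᵇ c) + 𝟙 (suc c ≡ᵇ x))
    ≡⟨ ∑-distrib-+ n _ _ ⟩
  ∑ n (λ x → 𝟙 (suc x ≡ᵇ c)) + ∑ n (λ x → 𝟙 (suc c ≡ᵇ x))
    ≡⟨ cong (∑ n (λ x → 𝟙 (suc x ≡ᵇ c)) +_) (∑-cong n (λ x → cong 𝟙 (≡ᵇ-sym (suc c) x))) ⟩
  ∑ n (λ x → 𝟙 (suc x ≡ᵇ c)) + ∑ n (λ x → 𝟙 (x ≡ᵇ suc c))
    ≤⟨ +-mono-≤ (predecessors≤1 c) (∑-𝟙-≡ᵇ≤1 n (suc c)) ⟩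
  2 ∎
  where
  open ≤-Reasoning
  predecessors≤1 : ∀ c → ∑ n (λ x → 𝟙 (suc x ≡ᵇ c)) ≤ 1
  predecessors≤1 zero    = ≤-trans (≤-reflexive (∑-zero n)) z≤n
  predecessors≤1 (suc c) = ∑-𝟙-≡ᵇ≤1 n c

nbhdSize : ℕ → ℕ → Cell → ℕ
nbhdSize h w s = ∑ h λ a → ∑ w λ b → 𝟙 (closeᵇ (a , b) s)

𝟙-closeᵇ-≤ : ∀ x y g k →
  𝟙 ((x ∧ y) ∨ ((x ∧ g) ∨ (y ∧ k))) ≤ 𝟙 x * (𝟙 y + 𝟙 g) + 𝟙 k * 𝟙 y
𝟙-closeᵇ-≤ true  true  g     k     = s≤s z≤n
𝟙-closeᵇ-≤ true  false true  k     = s≤s z≤n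
𝟙-closeᵇ-≤ true  false false k     = z≤n
𝟙-closeᵇ-≤ false true  g     true  = s≤s z≤n
𝟙-closeᵇ-≤ false true  g     false = z≤n
𝟙-closeᵇ-≤ false false g     k     = z≤n

-- N[(c , d)] meets row c in at most 3 cells and the rest of column d in pathDegree h c cells.
nbhdSize≤3+pathDegree : ∀ h w c d → nbhdSize h w (c , d) ≤ 3 + pathDegree h c
nbhdSize≤3+pathDegree h w c d = begin
  nbhdSize h w (c , d)
    ≤⟨ ∑-mono-≤ h (λ a → ∑-mono-≤ w (λ b →
         𝟙-closeᵇ-≤ (a ≡ᵇ c) (b ≡ᵇ d) (adjacentᵇ b d) (adjacentᵇ a c))) ⟩
  ∑ h (λ a → ∑ w (λ b → row a * (col b + colAdj b) + rowAdj a * col b))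
    ≡⟨ ∑-cong h (λ a → trans (∑-distrib-+ w _ _)
         (cong₂ _+_ (∑-*ˡ w (row a) _) (∑-*ˡ w (rowAdj a) col))) ⟩
  ∑ h (λ a → row a * ∑ w (λ b → col b + colAdj b) + rowAdj a * ∑ w col)
    ≡⟨ trans (∑-distrib-+ h _ _) (cong₂ _+_ (∑-*ʳ h _ row) (∑-*ʳ h _ rowAdj)) ⟩
  ∑ h row * ∑ w (λ b → col b + colAdj b) + pathDegree h c * ∑ w col
    ≤⟨ +-mono-≤ (*-mono-≤ (∑-𝟙-≡ᵇ≤1 h c) cross) (*-monoʳ-≤ (pathDegree h c) (∑-𝟙-≡ᵇ≤1 w d)) ⟩
  1 * 3 + pathDegree h c * 1
    ≡⟨ cong (3 +_) (*-identityʳ (pathDegree h c)) ⟩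
  3 + pathDegree h c ∎
  where
  open ≤-Reasoning
  row rowAdj col colAdj : ℕ → ℕ
  row a    = 𝟙 (a ≡ᵇ c)
  rowAdj a = 𝟙 (adjacentᵇ a c)
  col b    = 𝟙 (b ≡ᵇ d)
  colAdj b = 𝟙 (adjacentᵇ b d)
  cross : ∑ w (λ b → col b + colAdj b) ≤ 3
  cross = ≤-trans (≤-reflexive (∑-distrib-+ w col colAdj))
                  (+-mono-≤ (∑-𝟙-≡ᵇ≤1 w d) (pathDegree≤2 w d))

coverage-[] : ∀ o h w → coverage [] o h w ≡ 0
coverage-[] o h w = trans (∑-cong h (λ _ → ∑-zero w)) (∑-zero h)

coverage-∷ : ∀ s S h w → coverage (s ∷ S) (0 , 0) h w ≤ nbhdSize h w s + coverage S (0 , 0) h w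
coverage-∷ s S h w = ≤-trans
  (∑-mono-≤ h (λ a → ≤-trans (∑-mono-≤ w (λ b → 𝟙-∨ (closeᵇ (a , b) s) _))
                              (≤-reflexive (∑-distrib-+ w _ _))))
  (≤-reflexive (∑-distrib-+ h _ _))

coverage≤[3+K]*length : ∀ {h K} w → (∀ {c} → c < h → pathDegree h c ≤ K) →
  ∀ S → All (λ s → proj₁ s < h) S → coverage S (0 , 0) h w ≤ (3 + K) * length S
coverage≤[3+K]*length {h} w degree≤K [] [] = ≤-trans (≤-reflexive (coverage-[] (0 , 0) h w)) z≤n
coverage≤[3+K]*length {h} {K} w degree≤K ((c , d) ∷ S) (c<h ∷ S<h) = begin
  coverage ((c , d) ∷ S) (0 , 0) h w      ≤⟨ coverage-∷ (c , d) S h w ⟩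
  nbhdSize h w (c , d) + coverage S (0 , 0) h w
    ≤⟨ +-mono-≤ (≤-trans (nbhdSize≤3+pathDegree h w c d) (+-monoʳ-≤ 3 (degree≤K c<h)))
                (coverage≤[3+K]*length w degree≤K S S<h) ⟩
  (3 + K) + (3 + K) * length S            ≡⟨ *-suc (3 + K) (length S) ⟨
  (3 + K) * suc (length S)                ∎
  where open ≤-Reasoning

halfDominating-length : ∀ {m n K} → (∀ {c} → c < m → pathDegree m c ≤ K) →
  (S : List (Vertex m n)) → IsPDominating 1 2 S → m * n ≤ length S * (2 * (3 + K))
halfDominating-length {m} {n} {K} degree≤K S dominating = begin
  m * n                                    ≡⟨ *-identityˡ (m * n) ⟨
  1 * (m * n)                              ≤⟨ dominating ⟩
  2 * closedNbhdSize S                     ≡⟨ cong (2 *_) (closedNbhdSize≡coverage S) ⟩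
  2 * coverage (map toCell S) (0 , 0) m n
    ≤⟨ *-monoʳ-≤ 2 (coverage≤[3+K]*length n degree≤K (map toCell S)
                      (AllP.map⁺ (All.universal (λ (a , _) → toℕ<n a) S))) ⟩
  2 * ((3 + K) * length (map toCell S))    ≡⟨ cong (λ l → 2 * ((3 + K) * l)) (length-map toCell S) ⟩
  2 * ((3 + K) * length S)                 ≡⟨ *-assoc 2 (3 + K) (length S) ⟨
  2 * (3 + K) * length S                   ≡⟨ *-comm (2 * (3 + K)) (length S) ⟩
  length S * (2 * (3 + K))                 ∎
  where open ≤-Reasoning

pathDegree-P₁ : ∀ {c} → c < 1 → pathDegree 1 c ≤ 0
pathDegree-P₁ {zero}  _        = z≤n
pathDegree-P₁ {suc _} (s≤s ())

pathDegree-P₂ : ∀ {c} → c < 2 → pathDegree 2 c ≤ 1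
pathDegree-P₂ {zero}        _                = ≤-refl
pathDegree-P₂ {suc zero}    _                = ≤-refl
pathDegree-P₂ {suc (suc _)} (s≤s (s≤s ()))

ceilDiv-*-+ : ∀ y x d → ceilDiv (y * suc d + x) d ≡ y + ceilDiv x d
ceilDiv-*-+ y x d = begin
  (y * suc d + x + d) / suc d           ≡⟨ cong (_/ suc d) (+-assoc (y * suc d) x d) ⟩
  (y * suc d + (x + d)) / suc d         ≡⟨ +-distrib-/-∣ˡ (x + d) (divides-refl y) ⟩
  y * suc d / suc d + (x + d) / suc d   ≡⟨ cong (_+ ceilDiv x d) (m*n/n≡m y (suc d)) ⟩
  y + ceilDiv x d                       ∎
  where open ≡-Reasoning

ceilDiv-* : ∀ y d → ceilDiv (y * suc d) d ≡ y
ceilDiv-* y d = begin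
  ceilDiv (y * suc d) d       ≡⟨ cong (λ x → ceilDiv x d) (+-identityʳ (y * suc d)) ⟨
  ceilDiv (y * suc d + 0) d   ≡⟨ ceilDiv-*-+ y 0 d ⟩
  y + d / suc d               ≡⟨ cong (y +_) (m<n⇒m/n≡0 (n<1+n d)) ⟩
  y + 0                       ≡⟨ +-identityʳ y ⟩
  y                           ∎
  where open ≡-Reasoning

ceilDiv-≤ : ∀ {x y} d → x ≤ y * suc d → ceilDiv x d ≤ y
ceilDiv-≤ {y = y} d x≤y*[1+d] =
  ≤-trans (/-monoˡ-≤ (suc d) (+-monoˡ-≤ d x≤y*[1+d])) (≤-reflexive (ceilDiv-* y d))

ceilDiv-+ : ∀ x y d → ceilDiv (x * suc d + y) d ≡ ceilDiv (x * suc d) d + ceilDiv y d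
ceilDiv-+ x y d = trans (ceilDiv-*-+ x y d) (cong (_+ ceilDiv y d) (sym (ceilDiv-* x d)))

ceilDiv-+ˡ : ∀ x y d → ceilDiv (suc d * x + y) d ≡ ceilDiv (suc d * x) d + ceilDiv y d
ceilDiv-+ˡ x y d rewrite *-comm (suc d) x = ceilDiv-+ x y d

Inside : ℕ → ℕ → Cell → Set
Inside h w u = proj₁ u < h × proj₂ u < w

IsHalfCover : ℕ → ℕ → ℕ → List Cell → Set
IsHalfCover h w k S = All (Inside h w) S × length S ≤ k × h * w ≤ 2 * coverage S (0 , 0) h w

HalfCover : ℕ → ℕ → ℕ → Set
HalfCover h w k = Σ (List Cell) (IsHalfCover h w k)

isHalfCover? : ∀ h w k S → Dec (IsHalfCover h w k S)
isHalfCover? h w k S =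
  All.all? (λ u → proj₁ u <? h ×-dec proj₂ u <? w) S ×-dec
  length S ≤? k ×-dec
  h * w ≤? 2 * coverage S (0 , 0) h w

glue : ∀ {h w h₁ w₁ h₂ w₂ k₁ k₂} (o : Cell) →
  (∀ {u} → Inside h₁ w₁ u → Inside h w u) → (∀ {u} → Inside h₂ w₂ u → Inside h w (o ⊕ u)) →
  h * w ≡ h₁ * w₁ + h₂ * w₂ →
  (∀ S → coverage S (0 , 0) h w ≡ coverage S (0 , 0) h₁ w₁ + coverage S o h₂ w₂) →
  HalfCover h₁ w₁ k₁ → HalfCover h₂ w₂ k₂ → HalfCover h w (k₁ + k₂)
glue {h} {w} {h₁} {w₁} {h₂} {w₂} {k₁} {k₂} o inside₁ inside₂ area split
     (S₁ , S₁-inside , S₁-short , S₁-half) (S₂ , S₂-inside , S₂-short , S₂-half) =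
  S , S-inside , S-short , S-half
  where
  S : List Cell
  S = S₁ ++ translate o S₂
  S-inside : All (Inside h w) S
  S-inside = AllP.++⁺ (All.map inside₁ S₁-inside) (AllP.map⁺ (All.map inside₂ S₂-inside))
  S-short : length S ≤ k₁ + k₂
  S-short = begin
    length S                           ≡⟨ length-++ S₁ ⟩
    length S₁ + length (translate o S₂) ≡⟨ cong (length S₁ +_) (length-map (o ⊕_) S₂) ⟩
    length S₁ + length S₂              ≤⟨ +-mono-≤ S₁-short S₂-short ⟩
    k₁ + k₂                            ∎
    where open ≤-Reasoning
  S-half : h * w ≤ 2 * coverage S (0 , 0) h w
  S-half = begin
    h * w                                        ≡⟨ area ⟩
    h₁ * w₁ + h₂ * w₂                            ≤⟨ +-mono-≤ S₁-half S₂-half ⟩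
    2 * coverage S₁ (0 , 0) h₁ w₁ + 2 * coverage S₂ (0 , 0) h₂ w₂
      ≡⟨ *-distribˡ-+ 2 (coverage S₁ (0 , 0) h₁ w₁) _ ⟨
    2 * (coverage S₁ (0 , 0) h₁ w₁ + coverage S₂ (0 , 0) h₂ w₂)
      ≤⟨ *-monoʳ-≤ 2 (+-mono-≤ (coverage-++ˡ S₁ (translate o S₂) (0 , 0) h₁ w₁)
           (≤-trans (≤-reflexive (sym (coverage-translate o S₂ h₂ w₂)))
                    (coverage-++ʳ S₁ (translate o S₂) o h₂ w₂))) ⟩
    2 * (coverage S (0 , 0) h₁ w₁ + coverage S o h₂ w₂) ≡⟨ cong (2 *_) (split S) ⟨
    2 * coverage S (0 , 0) h w                   ∎
    where open ≤-Reasoning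

glueColumns : ∀ {h w₁ w₂ k₁ k₂} →
  HalfCover h w₁ k₁ → HalfCover h w₂ k₂ → HalfCover h (w₁ + w₂) (k₁ + k₂)
glueColumns {h} {w₁} {w₂} = glue (0 , w₁)
  (λ (a<h , b<w₁) → a<h , ≤-trans b<w₁ (m≤m+n w₁ w₂))
  (λ (a<h , b<w₂) → a<h , +-monoʳ-< w₁ b<w₂)
  (*-distribˡ-+ h w₁ w₂)
  (λ S → trans (∑-cong h (λ a → ∑-+ w₁ w₂ _)) (∑-distrib-+ h _ _))

glueRows : ∀ {h₁ h₂ w k₁ k₂} →
  HalfCover h₁ w k₁ → HalfCover h₂ w k₂ → HalfCover (h₁ + h₂) w (k₁ + k₂)
glueRows {h₁} {h₂} {w} = glue (h₁ , 0)
  (λ (a<h₁ , b<w) → ≤-trans a<h₁ (m≤m+n h₁ h₂) , b<w)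
  (λ (a<h₂ , b<w) → +-monoʳ-< h₁ a<h₂ , b<w)
  (*-distribʳ-+ w h₁ h₂)
  (λ S → ∑-+ h₁ h₂ _)

periodicInduction : (P : ℕ → Set) (b d : ℕ) →
  (∀ {j} → j < suc d → P (b + j)) → (∀ {w} → b ≤ w → P w → P (suc d + w)) →
  ∀ w → b ≤ w → P w
periodicInduction P b d base step = <-rec (λ w → b ≤ w → P w) go
  where
  go : ∀ w → (∀ {v} → v < w → b ≤ v → P v) → b ≤ w → P w
  go w rec b≤w with w <? b + suc d
  ... | yes w<b+[1+d] = subst P (m+[n∸m]≡n b≤w)
          (base (subst (w ∸ b <_) (m+n∸m≡n b (suc d)) (∸-monoˡ-< w<b+[1+d] b≤w)))
  ... | no  w≮b+[1+d] = subst P (m+[n∸m]≡n (m+n≤o⇒n≤o b b+[1+d]≤w))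
          (step b≤w∸[1+d] (rec (∸-monoʳ-< z<s (m+n≤o⇒n≤o b b+[1+d]≤w)) b≤w∸[1+d]))
    where
    b+[1+d]≤w : b + suc d ≤ w
    b+[1+d]≤w = ≮⇒≥ w≮b+[1+d]
    b≤w∸[1+d] : b ≤ w ∸ suc d
    b≤w∸[1+d] = subst (_≤ w ∸ suc d) (m+n∸n≡m b (suc d)) (∸-monoˡ-≤ (suc d) b+[1+d]≤w)

extendColumns : ∀ {h b d q} (k : ℕ → ℕ) → (∀ w → k (suc d + w) ≡ q + k w) →
  HalfCover h (suc d) q → (∀ {j} → j < suc d → HalfCover h (b + j) (k (b + j))) →
  ∀ w → b ≤ w → HalfCover h w (k w)
extendColumns {h} {b} {d} k k-step block base =
  periodicInduction (λ w → HalfCover h w (k w)) b d base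
    (λ {w} _ cover → subst (HalfCover h (suc d + w)) (sym (k-step w)) (glueColumns block cover))

-- Found by computer search; tableCovers checks each entry by evaluation.
coverTable : ℕ → ℕ → List Cell
coverTable 1 1 = (0 , 0) ∷ []
coverTable 1 2 = (0 , 0) ∷ []
coverTable 1 3 = (0 , 2) ∷ []
coverTable 1 4 = (0 , 0) ∷ []
coverTable 1 5 = (0 , 2) ∷ []
coverTable 1 6 = (0 , 3) ∷ []
coverTable 2 1 = (0 , 0) ∷ []
coverTable 2 2 = (1 , 1) ∷ []
coverTable 2 3 = (0 , 0) ∷ []
coverTable 2 4 = (1 , 2) ∷ []
coverTable 3 3 = (1 , 1) ∷ []
coverTable 3 4 = (0 , 2) ∷ (2 , 0) ∷ []
coverTable 3 5 = (0 , 2) ∷ (1 , 4) ∷ []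
coverTable 3 6 = (1 , 2) ∷ (2 , 4) ∷ []
coverTable 3 7 = (1 , 1) ∷ (1 , 2) ∷ (2 , 6) ∷ []
coverTable 3 8 = (0 , 5) ∷ (1 , 0) ∷ (1 , 3) ∷ []
coverTable 3 9 = (0 , 1) ∷ (1 , 3) ∷ (1 , 7) ∷ []
coverTable 3 10 = (1 , 1) ∷ (1 , 4) ∷ (1 , 8) ∷ []
coverTable 3 11 = (0 , 1) ∷ (1 , 5) ∷ (1 , 9) ∷ (2 , 7) ∷ []
coverTable 3 12 = (0 , 10) ∷ (1 , 2) ∷ (1 , 8) ∷ (2 , 4) ∷ []
coverTable 4 3 = (1 , 0) ∷ (3 , 0) ∷ []
coverTable 4 4 = (0 , 2) ∷ (3 , 2) ∷ []
coverTable 4 5 = (1 , 3) ∷ (2 , 1) ∷ []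
coverTable 4 6 = (0 , 2) ∷ (2 , 0) ∷ (3 , 4) ∷ []
coverTable 4 7 = (1 , 3) ∷ (1 , 5) ∷ (2 , 1) ∷ []
coverTable 4 8 = (0 , 3) ∷ (0 , 6) ∷ (1 , 0) ∷ (3 , 5) ∷ []
coverTable 4 9 = (1 , 1) ∷ (1 , 7) ∷ (3 , 3) ∷ (3 , 6) ∷ []
coverTable 4 10 = (1 , 3) ∷ (2 , 1) ∷ (2 , 5) ∷ (2 , 8) ∷ []
coverTable 4 11 = (1 , 1) ∷ (1 , 5) ∷ (1 , 9) ∷ (3 , 2) ∷ (3 , 10) ∷ []
coverTable 4 12 = (1 , 2) ∷ (1 , 5) ∷ (1 , 8) ∷ (2 , 10) ∷ (3 , 6) ∷ []
coverTable 5 3 = (2 , 0) ∷ (3 , 2) ∷ []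
coverTable 5 4 = (1 , 1) ∷ (3 , 2) ∷ []
coverTable 5 5 = (0 , 3) ∷ (2 , 0) ∷ (3 , 3) ∷ []
coverTable 5 6 = (1 , 2) ∷ (2 , 4) ∷ (3 , 1) ∷ []
coverTable 5 7 = (1 , 1) ∷ (2 , 4) ∷ (3 , 2) ∷ (4 , 6) ∷ []
coverTable 5 8 = (1 , 1) ∷ (1 , 5) ∷ (3 , 3) ∷ (3 , 6) ∷ []
coverTable 5 9 = (1 , 3) ∷ (1 , 8) ∷ (2 , 6) ∷ (3 , 4) ∷ (4 , 1) ∷ []
coverTable 5 10 = (1 , 3) ∷ (2 , 1) ∷ (2 , 6) ∷ (3 , 4) ∷ (3 , 8) ∷ []
coverTable 5 11 = (0 , 6) ∷ (0 , 9) ∷ (1 , 2) ∷ (2 , 4) ∷ (2 , 7) ∷ (3 , 9) ∷ []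
coverTable 5 12 = (1 , 1) ∷ (1 , 5) ∷ (1 , 9) ∷ (2 , 3) ∷ (3 , 7) ∷ (3 , 10) ∷ []
coverTable 6 3 = (1 , 2) ∷ (3 , 1) ∷ []
coverTable 6 4 = (0 , 2) ∷ (3 , 0) ∷ (5 , 1) ∷ []
coverTable 6 5 = (1 , 1) ∷ (3 , 3) ∷ (4 , 1) ∷ []
coverTable 6 6 = (1 , 0) ∷ (1 , 3) ∷ (4 , 4) ∷ (5 , 1) ∷ []
coverTable 6 7 = (0 , 2) ∷ (0 , 5) ∷ (1 , 1) ∷ (4 , 1) ∷ (4 , 4) ∷ []
coverTable 6 8 = (0 , 3) ∷ (1 , 1) ∷ (1 , 5) ∷ (3 , 4) ∷ (4 , 1) ∷ []
coverTable 6 9 = (1 , 2) ∷ (1 , 5) ∷ (1 , 7) ∷ (2 , 1) ∷ (3 , 6) ∷ (4 , 2) ∷ []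
coverTable 6 10 = (1 , 1) ∷ (2 , 6) ∷ (3 , 3) ∷ (4 , 1) ∷ (4 , 5) ∷ (4 , 8) ∷ []
coverTable 6 11 = (0 , 2) ∷ (1 , 9) ∷ (2 , 7) ∷ (3 , 2) ∷ (4 , 4) ∷ (4 , 9) ∷ (5 , 7) ∷ []
coverTable 6 12 = (0 , 2) ∷ (0 , 10) ∷ (1 , 0) ∷ (1 , 4) ∷ (2 , 6) ∷ (3 , 2) ∷ (3 , 9) ∷
  (5 , 7) ∷ []
coverTable 7 3 = (0 , 1) ∷ (1 , 1) ∷ (3 , 1) ∷ []
coverTable 7 4 = (2 , 0) ∷ (3 , 2) ∷ (5 , 1) ∷ []
coverTable 7 5 = (0 , 3) ∷ (1 , 1) ∷ (4 , 2) ∷ (6 , 3) ∷ []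
coverTable 7 6 = (1 , 1) ∷ (2 , 4) ∷ (5 , 2) ∷ (5 , 5) ∷ (6 , 3) ∷ []
coverTable 7 7 = (1 , 4) ∷ (2 , 1) ∷ (3 , 3) ∷ (5 , 1) ∷ (5 , 5) ∷ []
coverTable 7 8 = (0 , 1) ∷ (2 , 2) ∷ (2 , 6) ∷ (4 , 5) ∷ (5 , 1) ∷ (5 , 7) ∷ []
coverTable 7 9 = (0 , 6) ∷ (1 , 2) ∷ (1 , 8) ∷ (2 , 5) ∷ (3 , 7) ∷ (4 , 4) ∷ (5 , 2) ∷ []
coverTable 7 10 = (1 , 1) ∷ (2 , 8) ∷ (3 , 4) ∷ (4 , 1) ∷ (4 , 6) ∷ (5 , 3) ∷ (5 , 8) ∷ []
coverTable 7 11 = (1 , 5) ∷ (2 , 2) ∷ (2 , 10) ∷ (3 , 6) ∷ (4 , 1) ∷ (4 , 9) ∷ (5 , 3) ∷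
  (5 , 7) ∷ []
coverTable 7 12 = (0 , 9) ∷ (1 , 3) ∷ (1 , 7) ∷ (2 , 5) ∷ (2 , 10) ∷ (4 , 1) ∷ (4 , 6) ∷
  (4 , 9) ∷ (6 , 11) ∷ []
coverTable 8 3 = (1 , 0) ∷ (1 , 2) ∷ (4 , 1) ∷ []
coverTable 8 4 = (0 , 2) ∷ (1 , 0) ∷ (2 , 2) ∷ (5 , 1) ∷ []
coverTable 8 5 = (1 , 3) ∷ (2 , 1) ∷ (4 , 3) ∷ (6 , 1) ∷ []
coverTable 8 6 = (1 , 2) ∷ (2 , 4) ∷ (5 , 1) ∷ (6 , 4) ∷ (7 , 2) ∷ []
coverTable 8 7 = (1 , 4) ∷ (2 , 2) ∷ (2 , 6) ∷ (4 , 1) ∷ (5 , 4) ∷ (7 , 5) ∷ []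
coverTable 8 8 = (1 , 0) ∷ (1 , 5) ∷ (2 , 2) ∷ (2 , 7) ∷ (3 , 4) ∷ (4 , 2) ∷ (6 , 1) ∷ []
coverTable 8 9 = (0 , 4) ∷ (1 , 0) ∷ (1 , 7) ∷ (2 , 2) ∷ (2 , 5) ∷ (3 , 5) ∷ (5 , 1) ∷ (6 , 5) ∷ []
coverTable 8 10 = (1 , 1) ∷ (1 , 5) ∷ (2 , 8) ∷ (3 , 3) ∷ (3 , 6) ∷ (4 , 1) ∷ (5 , 4) ∷
  (6 , 2) ∷ []
coverTable 8 11 = (0 , 5) ∷ (1 , 3) ∷ (1 , 9) ∷ (2 , 1) ∷ (3 , 4) ∷ (3 , 7) ∷ (5 , 1) ∷
  (5 , 5) ∷ (5 , 9) ∷ []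
coverTable 8 12 = (1 , 2) ∷ (3 , 3) ∷ (3 , 6) ∷ (3 , 9) ∷ (4 , 0) ∷ (5 , 5) ∷ (5 , 10) ∷
  (6 , 1) ∷ (6 , 8) ∷ (7 , 6) ∷ []
coverTable 9 3 = (2 , 0) ∷ (4 , 1) ∷ (7 , 1) ∷ []
coverTable 9 4 = (1 , 3) ∷ (4 , 2) ∷ (6 , 1) ∷ (7 , 3) ∷ []
coverTable 9 5 = (1 , 1) ∷ (1 , 2) ∷ (3 , 3) ∷ (6 , 3) ∷ (7 , 1) ∷ []
coverTable 9 6 = (2 , 2) ∷ (2 , 5) ∷ (3 , 0) ∷ (5 , 3) ∷ (6 , 1) ∷ (8 , 3) ∷ []
coverTable 9 7 = (0 , 3) ∷ (1 , 1) ∷ (1 , 5) ∷ (4 , 1) ∷ (4 , 4) ∷ (7 , 1) ∷ (7 , 4) ∷ []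
coverTable 9 8 = (1 , 7) ∷ (2 , 3) ∷ (4 , 1) ∷ (4 , 4) ∷ (5 , 6) ∷ (7 , 1) ∷ (7 , 3) ∷ (7 , 7) ∷ []
coverTable 9 9 = (0 , 2) ∷ (0 , 5) ∷ (1 , 8) ∷ (2 , 0) ∷ (2 , 6) ∷ (4 , 1) ∷ (5 , 5) ∷ (6 , 7) ∷
  (7 , 2) ∷ []
coverTable 9 10 = (1 , 3) ∷ (2 , 1) ∷ (2 , 6) ∷ (3 , 8) ∷ (4 , 3) ∷ (5 , 1) ∷ (5 , 5) ∷
  (7 , 2) ∷ (7 , 6) ∷ []
coverTable 9 11 = (1 , 1) ∷ (1 , 6) ∷ (1 , 9) ∷ (2 , 4) ∷ (3 , 2) ∷ (3 , 7) ∷ (4 , 5) ∷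
  (5 , 8) ∷ (6 , 3) ∷ (7 , 5) ∷ []
coverTable 9 12 = (1 , 6) ∷ (1 , 10) ∷ (2 , 4) ∷ (3 , 1) ∷ (4 , 3) ∷ (4 , 8) ∷ (5 , 6) ∷
  (6 , 4) ∷ (6 , 9) ∷ (7 , 7) ∷ (8 , 10) ∷ []
coverTable 10 3 = (1 , 1) ∷ (4 , 1) ∷ (8 , 1) ∷ []
coverTable 10 4 = (1 , 2) ∷ (3 , 1) ∷ (5 , 2) ∷ (8 , 1) ∷ []
coverTable 10 5 = (1 , 1) ∷ (2 , 3) ∷ (5 , 1) ∷ (6 , 3) ∷ (8 , 2) ∷ []
coverTable 10 6 = (2 , 1) ∷ (2 , 4) ∷ (4 , 3) ∷ (6 , 1) ∷ (6 , 4) ∷ (8 , 3) ∷ []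
coverTable 10 7 = (1 , 1) ∷ (1 , 4) ∷ (3 , 2) ∷ (4 , 4) ∷ (5 , 1) ∷ (6 , 5) ∷ (7 , 2) ∷ []
coverTable 10 8 = (1 , 1) ∷ (1 , 5) ∷ (3 , 4) ∷ (4 , 1) ∷ (5 , 5) ∷ (6 , 3) ∷ (8 , 2) ∷
  (8 , 6) ∷ []
coverTable 10 9 = (1 , 3) ∷ (2 , 1) ∷ (3 , 4) ∷ (3 , 7) ∷ (5 , 6) ∷ (6 , 1) ∷ (6 , 4) ∷
  (8 , 2) ∷ (8 , 6) ∷ []
coverTable 10 10 = (1 , 3) ∷ (2 , 1) ∷ (3 , 6) ∷ (4 , 4) ∷ (4 , 8) ∷ (5 , 2) ∷ (6 , 7) ∷
  (7 , 3) ∷ (8 , 1) ∷ (8 , 6) ∷ []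
coverTable 10 11 = (1 , 2) ∷ (1 , 5) ∷ (2 , 9) ∷ (3 , 1) ∷ (3 , 6) ∷ (4 , 4) ∷ (4 , 8) ∷
  (6 , 5) ∷ (7 , 3) ∷ (7 , 8) ∷ (8 , 6) ∷ []
coverTable 10 12 = (1 , 5) ∷ (2 , 3) ∷ (2 , 9) ∷ (3 , 1) ∷ (4 , 5) ∷ (4 , 8) ∷ (6 , 2) ∷
  (6 , 6) ∷ (7 , 8) ∷ (8 , 1) ∷ (8 , 4) ∷ (8 , 10) ∷ []
coverTable 11 3 = (0 , 1) ∷ (4 , 0) ∷ (5 , 2) ∷ (9 , 1) ∷ []
coverTable 11 4 = (1 , 2) ∷ (4 , 3) ∷ (5 , 0) ∷ (8 , 3) ∷ (9 , 1) ∷ []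
coverTable 11 5 = (2 , 0) ∷ (3 , 2) ∷ (5 , 0) ∷ (5 , 3) ∷ (7 , 1) ∷ (9 , 3) ∷ []
coverTable 11 6 = (2 , 1) ∷ (2 , 4) ∷ (5 , 2) ∷ (6 , 4) ∷ (8 , 3) ∷ (9 , 0) ∷ (10 , 2) ∷ []
coverTable 11 7 = (1 , 1) ∷ (2 , 3) ∷ (4 , 4) ∷ (5 , 1) ∷ (7 , 5) ∷ (8 , 3) ∷ (9 , 1) ∷
  (9 , 6) ∷ []
coverTable 11 8 = (1 , 2) ∷ (1 , 6) ∷ (2 , 4) ∷ (4 , 1) ∷ (5 , 4) ∷ (7 , 1) ∷ (8 , 6) ∷
  (9 , 0) ∷ (9 , 3) ∷ []
coverTable 11 9 = (1 , 1) ∷ (1 , 4) ∷ (1 , 7) ∷ (4 , 1) ∷ (4 , 6) ∷ (5 , 4) ∷ (6 , 2) ∷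
  (8 , 7) ∷ (9 , 2) ∷ (9 , 5) ∷ []
coverTable 11 10 = (1 , 6) ∷ (2 , 8) ∷ (3 , 2) ∷ (3 , 5) ∷ (4 , 7) ∷ (5 , 1) ∷ (5 , 4) ∷
  (6 , 6) ∷ (7 , 2) ∷ (8 , 7) ∷ (9 , 1) ∷ []
coverTable 11 11 = (1 , 3) ∷ (1 , 9) ∷ (2 , 5) ∷ (2 , 7) ∷ (4 , 2) ∷ (4 , 10) ∷ (5 , 4) ∷
  (6 , 1) ∷ (6 , 5) ∷ (7 , 3) ∷ (7 , 8) ∷ (9 , 1) ∷ (9 , 4) ∷ []
coverTable 11 12 = (0 , 10) ∷ (1 , 0) ∷ (1 , 6) ∷ (3 , 7) ∷ (4 , 3) ∷ (5 , 5) ∷ (5 , 8) ∷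
  (5 , 10) ∷ (7 , 1) ∷ (7 , 9) ∷ (8 , 5) ∷ (9 , 2) ∷ (9 , 7) ∷ (10 , 4) ∷ []
coverTable 12 3 = (0 , 1) ∷ (2 , 2) ∷ (4 , 1) ∷ (8 , 1) ∷ []
coverTable 12 4 = (1 , 2) ∷ (4 , 1) ∷ (7 , 2) ∷ (9 , 3) ∷ (10 , 1) ∷ []
coverTable 12 5 = (1 , 2) ∷ (4 , 1) ∷ (5 , 3) ∷ (7 , 1) ∷ (8 , 3) ∷ (10 , 2) ∷ []
coverTable 12 6 = (0 , 3) ∷ (1 , 1) ∷ (3 , 4) ∷ (4 , 1) ∷ (6 , 0) ∷ (6 , 2) ∷ (10 , 2) ∷
  (10 , 4) ∷ []
coverTable 12 7 = (1 , 4) ∷ (2 , 2) ∷ (4 , 0) ∷ (4 , 5) ∷ (6 , 2) ∷ (7 , 4) ∷ (8 , 6) ∷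
  (9 , 0) ∷ (10 , 2) ∷ []
coverTable 12 8 = (1 , 0) ∷ (1 , 6) ∷ (2 , 4) ∷ (3 , 1) ∷ (4 , 6) ∷ (6 , 6) ∷ (7 , 4) ∷
  (8 , 2) ∷ (10 , 1) ∷ (10 , 6) ∷ []
coverTable 12 9 = (1 , 3) ∷ (1 , 8) ∷ (2 , 5) ∷ (3 , 2) ∷ (5 , 3) ∷ (6 , 7) ∷ (7 , 1) ∷
  (7 , 5) ∷ (9 , 6) ∷ (10 , 1) ∷ (10 , 4) ∷ []
coverTable 12 10 = (1 , 4) ∷ (2 , 1) ∷ (2 , 7) ∷ (3 , 5) ∷ (4 , 3) ∷ (4 , 8) ∷ (5 , 1) ∷
  (6 , 4) ∷ (8 , 8) ∷ (9 , 6) ∷ (10 , 1) ∷ (10 , 4) ∷ []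
coverTable 12 11 = (0 , 5) ∷ (2 , 2) ∷ (2 , 4) ∷ (2 , 9) ∷ (3 , 7) ∷ (4 , 5) ∷ (5 , 2) ∷
  (6 , 9) ∷ (7 , 7) ∷ (8 , 3) ∷ (8 , 10) ∷ (9 , 8) ∷ (10 , 6) ∷ (11 , 3) ∷ []
coverTable 12 12 = (1 , 1) ∷ (1 , 9) ∷ (2 , 7) ∷ (3 , 3) ∷ (4 , 0) ∷ (4 , 8) ∷ (4 , 10) ∷
  (6 , 1) ∷ (6 , 6) ∷ (7 , 10) ∷ (8 , 3) ∷ (9 , 8) ∷ (10 , 4) ∷ (10 , 10) ∷ (11 , 6) ∷ []
coverTable _ _ = []

tableValid? : ∀ h b n (k : ℕ → ℕ) →
  Dec (All (λ j → IsHalfCover h (b + j) (k (b + j)) (coverTable h (b + j))) (upTo n))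
tableValid? h b n k =
  All.all? (λ j → isHalfCover? h (b + j) (k (b + j)) (coverTable h (b + j))) (upTo n)

tableCovers : ∀ h b n (k : ℕ → ℕ) → True (tableValid? h b n k) →
  ∀ {j} → j < n → HalfCover h (b + j) (k (b + j))
tableCovers h b n k valid j<n = _ , All.lookup (toWitness valid) (∈-upTo⁺ j<n)

gridTablesValid :
  All (λ i → True (tableValid? (3 + i) 3 10 (λ w → ceilDiv ((3 + i) * w) 9))) (upTo 10)
gridTablesValid = toWitness {a? = All.all? (λ i → T? _) (upTo 10)} tt

pathCover : ∀ n → 1 ≤ n → HalfCover 1 n (ceilDiv n 5)
pathCover = extendColumns (λ w → ceilDiv w 5) (λ w → ceilDiv-+ 1 w 5) (covers (n<1+n 5)) covers
  where covers = tableCovers 1 1 6 (λ w → ceilDiv w 5) tt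

ladderCover : ∀ n → 1 ≤ n → HalfCover 2 n (ceilDiv n 3)
ladderCover = extendColumns (λ w → ceilDiv w 3) (λ w → ceilDiv-+ 1 w 3) (covers (n<1+n 3)) covers
  where covers = tableCovers 2 1 4 (λ w → ceilDiv w 3) tt

gridCoverOfHeight : ∀ {i} → i < 10 →
  ∀ w → 3 ≤ w → HalfCover (3 + i) w (ceilDiv ((3 + i) * w) 9)
gridCoverOfHeight {i} i<10 = extendColumns (λ w → ceilDiv (h * w) 9)
  (λ w → trans (cong (λ x → ceilDiv x 9) (*-distribˡ-+ h 10 w)) (ceilDiv-+ h (h * w) 9))
  (covers (m<m+n 7 z<s)) covers
  where
  h = 3 + i
  covers = tableCovers h 3 10 (λ w → ceilDiv (h * w) 9)
                       (All.lookup gridTablesValid (∈-upTo⁺ i<10))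

gridCover : ∀ m → 3 ≤ m → ∀ n → 3 ≤ n → HalfCover m n (ceilDiv (m * n) 9)
gridCover = periodicInduction (λ h → ∀ w → 3 ≤ w → HalfCover h w (ceilDiv (h * w) 9)) 3 9
  gridCoverOfHeight
  (λ {h} _ cover w 3≤w → subst (HalfCover (10 + h) w)
    (trans (sym (ceilDiv-+ˡ w (h * w) 9)) (cong (λ x → ceilDiv x 9) (sym (*-distribʳ-+ w 10 h))))
    (glueRows (gridCoverOfHeight (m<m+n 7 z<s) w 3≤w) (cover w 3≤w)))

toVertices : ∀ {m n} S → All (Inside m n) S → List (Vertex m n)
toVertices []      []                     = []
toVertices (_ ∷ S) ((a<m , b<n) ∷ inside) = (fromℕ< a<m , fromℕ< b<n) ∷ toVertices S inside

map-toCell-toVertices : ∀ {m n} S (inside : All (Inside m n) S) →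
  map toCell (toVertices S inside) ≡ S
map-toCell-toVertices []      []                     = refl
map-toCell-toVertices (_ ∷ S) ((a<m , b<n) ∷ inside) =
  cong₂ _∷_ (cong₂ _,_ (toℕ-fromℕ< a<m) (toℕ-fromℕ< b<n)) (map-toCell-toVertices S inside)

isPDominationNumber : ∀ {m n k} → HalfCover m n k → (∀ S → IsPDominating 1 2 S → k ≤ length S) →
  IsPDominationNumber m n 1 2 k
isPDominationNumber {m} {n} {k} (cells , inside , short , half) lower =
  (D , deduplicate-! _≟ᵛ_ C , ≤-antisym D-short (lower D D-dominating) , D-dominating) ,
  λ S _ → lower S
  where
  C D : List (Vertex m n)
  C = toVertices cells inside
  D = deduplicate _≟ᵛ_ C
  D-short : length D ≤ k
  D-short = begin
    length D                  ≤⟨ length-deduplicate _≟ᵛ_ C ⟩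
    length C                  ≡⟨ length-map toCell C ⟨
    length (map toCell C)     ≡⟨ cong length (map-toCell-toVertices cells inside) ⟩
    length cells              ≤⟨ short ⟩
    k                         ∎
    where open ≤-Reasoning
  D-dominating : IsPDominating 1 2 D
  D-dominating = begin
    1 * (m * n)                           ≡⟨ *-identityˡ (m * n) ⟩
    m * n                                 ≤⟨ half ⟩
    2 * coverage cells (0 , 0) m n
      ≡⟨ cong (λ S → 2 * coverage S (0 , 0) m n) (map-toCell-toVertices cells inside) ⟨
    2 * coverage (map toCell C) (0 , 0) m n ≡⟨ cong (2 *_) (closedNbhdSize≡coverage C) ⟨
    2 * closedNbhdSize C                  ≡⟨ cong (2 *_) (closedNbhdSize-deduplicate C) ⟨
    2 * closedNbhdSize D                  ∎
    where open ≤-Reasoning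

γ½-path : ∀ n → 1 ≤ n → IsPDominationNumber 1 n 1 2 (ceilDiv n 5)
γ½-path n 1≤n = isPDominationNumber (pathCover n 1≤n) λ S dominating →
  ceilDiv-≤ {n} 5 (subst (_≤ length S * 6) (*-identityˡ n)
    (halfDominating-length pathDegree-P₁ S dominating))

γ½-ladder : ∀ n → 1 ≤ n → IsPDominationNumber 2 n 1 2 (ceilDiv n 3)
γ½-ladder n 1≤n = isPDominationNumber (ladderCover n 1≤n) λ S dominating →
  ceilDiv-≤ {n} 3 (*-cancelˡ-≤ 2 (subst (2 * n ≤_) (L*8≡2*[L*4] (length S))
    (halfDominating-length pathDegree-P₂ S dominating)))
  where
  L*8≡2*[L*4] : ∀ L → L * 8 ≡ 2 * (L * 4)
  L*8≡2*[L*4] L = trans (sym (*-assoc L 4 2)) (*-comm (L * 4) 2)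

γ½-grid : ∀ m n → 3 ≤ m → 3 ≤ n → IsPDominationNumber m n 1 2 (ceilDiv (m * n) 9)
γ½-grid m n 3≤m 3≤n = isPDominationNumber (gridCover m 3≤m n 3≤n) λ S dominating →
  ceilDiv-≤ 9 (halfDominating-length (λ {c} _ → pathDegree≤2 m c) S dominating)

theorem2p8 : (m n : ℕ) → 1 ≤ m → m ≤ n →
    (m ≡ 1 → IsPDominationNumber m n 1 2 (ceilDiv n 5))
    × (m ≡ 2 → IsPDominationNumber m n 1 2 (ceilDiv n 3))
    × (3 ≤ m → IsPDominationNumber m n 1 2 (ceilDiv (m * n) 9))
theorem2p8 m n 1≤m m≤n =
  (λ { refl → γ½-path n (≤-trans 1≤m m≤n) }) ,
  (λ { refl → γ½-ladder n (≤-trans 1≤m m≤n) }) ,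
  (λ 3≤m → γ½-grid m n 3≤m (≤-trans 3≤m m≤n))
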